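{- Let $N$ be a natural number, let $\delta\subseteq{}^{\underline N}2$ satisfy $\mathrm{hn}(\delta)>1$ and let $Z\subseteq N$. Then \[\mathrm{hn}(L(\delta,Z))\geq\tfrac12\mathrm{hn}(\delta)\quad\text{and}\quad\mathrm{hn}(R(\delta,Z))\geq\tfrac12\mathrm{hn}(\delta).\]
   Context: $N$ is identified with $\{0,\ldots,N-1\}$. ${}^{\underline N}2$ is the set of all partial functions $\sigma$ with $\mathrm{dom}(\sigma)\subseteq N$ and values in $\{0,1\}$ (including the empty function). For $\sigma\in{}^{\underline N}2$ and $Z\subseteq N$, $\sigma\restriction Z=\{(a,b)\in\sigma:a\in Z\}$. $L(\delta,Z)=\{\sigma\restriction Z:\sigma\in\delta,\ |\sigma\restriction Z|\geq|\sigma\restriction(N\setminus Z)|\}$ and $R(\delta,Z)=\{\sigma\restriction(N\setminus Z):\sigma\in\delta,\ |\sigma\restriction Z|<|\sigma\restriction(N\setminus Z)|\}$. For $\delta\subseteq{}^{\underline N}2$, $\mathrm{hn}(\delta)$ is the maximum of $k+1$ over $k\in\{0,\ldots,N-1\}$ such that for every $\delta'\subseteq\delta$ there is $\delta''\subseteq\delta'$ whose elements have pairwise disjoint domains and $|\bigcup_{\sigma\in\delta''}\mathrm{dom}(\sigma)|\geq k|\delta'|$. -}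

module Defs where

open import Data.Nat using (ℕ; zero; suc; _+_; _*_; _≤_; _<_)
open import Data.Bool using (Bool; true; false; if_then_else_)
open import Data.Bool.Properties using () renaming (_≟_ to _≟ᵇ_)
open import Data.Maybe using (Maybe; just; nothing; is-just)
open import Data.Maybe.Properties using (≡-dec)
open import Data.Fin using (Fin)
open import Data.Fin.Subset using (Subset; ⊥; _∪_; _∩_; ∁; ∣_∣; Empty)
open import Data.Vec using (Vec; map; zipWith)
import Data.Vec.Properties as VP
open import Data.List using (List; length; foldr; filter; deduplicate)
import Data.List as L
open import Data.List.Relation.Binary.Sublist.Propositional using (_⊆_)
open import Data.List.Relation.Unary.AllPairs using (AllPairs)
open import Data.Product using (Σ; _×_; ∃)
open import Relation.Nullary using (Dec)
open import Relation.Binary.PropositionalEquality using (_≡_)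
open import Relation.Binary using (DecidableEquality)

-- A partial function σ : N ⇀ 2, with N = Fin N; σ i = nothing means i ∉ dom σ.
PF : ℕ → Set
PF N = Vec (Maybe Bool) N

_≟PF_ : ∀ {N} → DecidableEquality (PF N)
_≟PF_ = VP.≡-dec (≡-dec _≟ᵇ_)

dom : ∀ {N} → PF N → Subset N
dom σ = map is-just σ

-- |σ| = cardinality of σ as a set of pairs = |dom σ|
size : ∀ {N} → PF N → ℕ
size σ = ∣ dom σ ∣

_↾_ : ∀ {N} → PF N → Subset N → PF N
σ ↾ Z = zipWith (λ z v → if z then v else nothing) Z σ

-- A finite set of partial functions: a list without duplicates
-- (the Unique hypothesis is imposed in the statement).
-- Subsets δ' ⊆ δ are sublists; cardinality is length.

domUnion : ∀ {N} → List (PF N) → Subset N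
domUnion δ = foldr (λ σ acc → dom σ ∪ acc) ⊥ δ

PairwiseDisjoint : ∀ {N} → List (PF N) → Set
PairwiseDisjoint = AllPairs (λ σ τ → Empty (dom σ ∩ dom τ))

Good : ∀ {N} → List (PF N) → ℕ → Set
Good δ k = ∀ δ' → δ' ⊆ δ →
  Σ (List _) λ δ'' → δ'' ⊆ δ' × PairwiseDisjoint δ''
    × k * length δ' ≤ ∣ domUnion δ'' ∣

IsHn : ∀ {N} → List (PF N) → ℕ → Set
IsHn {N} δ h = Σ ℕ λ k → (h ≡ suc k) × (k < N) × Good δ k
  × (∀ k' → k' < N → Good δ k' → k' ≤ k)

Lset : ∀ {N} → List (PF N) → Subset N → List (PF N)
Lset δ Z = deduplicate _≟PF_
  (L.map (λ σ → σ ↾ Z) (filter (λ σ → size (σ ↾ (∁ Z)) Data.Nat.≤? size (σ ↾ Z)) δ))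
  where import Data.Nat

Rset : ∀ {N} → List (PF N) → Subset N → List (PF N)
Rset δ Z = deduplicate _≟PF_
  (L.map (λ σ → σ ↾ (∁ Z)) (filter (λ σ → size (σ ↾ Z) Data.Nat.<? size (σ ↾ (∁ Z))) δ))
  where import Data.Nat

-- Every σ that survives in L(δ,Z) keeps at least half of its domain after restriction to Z,
-- and restriction only shrinks domains. So a family δ' ⊆ L(δ,Z) has a preimage in δ of the
-- same size; hn(δ) = k + 1 yields a pairwise disjoint subfamily of that preimage covering at
-- least k·|δ'| points, and its restrictions are again pairwise disjoint and cover at least
-- half as many. Hence ⌊k/2⌋ is admissible for L(δ,Z), and hn(L(δ,Z)) ≥ ⌊k/2⌋ + 1 ≥ (k+1)/2.
-- R(δ,Z) is symmetric.
module Submission where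

open import Defs
open import Data.Nat using (ℕ; zero; suc; _+_; _*_; _≤_; _<_; z≤n; s≤s; ⌊_/2⌋; _≤?_; _<?_)
open import Data.Nat.Properties
open import Data.Maybe using (just; nothing)
import Data.Fin as Fin
open import Data.Fin.Subset using (Subset; inside; outside; ∣_∣; _∪_; _∩_; ∁; Empty)
  renaming (⊥ to ∅; _⊆_ to _⊆ₛ_)
open import Data.Fin.Subset.Properties
  using (∉⊥; ∣⊥∣≡0; x∈p∩q⁺; x∈p∩q⁻; x∈p∪q⁻; Empty-unique; nonempty?)
open import Data.Vec using ([]; _∷_; here; there)
open import Data.List using (List; []; _∷_; length; map; filter; deduplicate)
open import Data.List.Properties using (length-map)
open import Data.List.Relation.Binary.Sublist.Propositional using (_⊆_; []; _∷_; _∷ʳ_; ⊆-trans)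
open import Data.List.Relation.Binary.Sublist.Propositional.Properties
  using (All-resp-⊆; map⁺; filter-⊆)
open import Data.List.Relation.Unary.All using (All; []; _∷_)
open import Data.List.Relation.Unary.All.Properties using (all-filter)
open import Data.List.Relation.Unary.AllPairs using ([]; _∷_; allPairs?)
open import Data.List.Relation.Unary.Unique.Propositional using (Unique)
open import Data.Product using (Σ; _×_; _,_; proj₂)
open import Data.Empty using (⊥-elim)
open import Data.Sum using (inj₁; inj₂)
open import Relation.Nullary using (Dec; yes; no; ¬?)
open import Relation.Nullary.Decidable using (_×-dec_)
open import Level using (0ℓ)
open import Relation.Unary using (Pred; Decidable)
open import Relation.Binary.PropositionalEquality using (_≡_; refl; sym; trans; cong; subst; module ≡-Reasoning)

private
  variable
    n : ℕ

∣p∪q∣+∣p∩q∣≡∣p∣+∣q∣ : (p q : Subset n) → ∣ p ∪ q ∣ + ∣ p ∩ q ∣ ≡ ∣ p ∣ + ∣ q ∣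
∣p∪q∣+∣p∩q∣≡∣p∣+∣q∣ [] [] = refl
∣p∪q∣+∣p∩q∣≡∣p∣+∣q∣ (inside ∷ p) (inside ∷ q) =
  cong suc (trans (+-suc _ _) (trans (cong suc (∣p∪q∣+∣p∩q∣≡∣p∣+∣q∣ p q)) (sym (+-suc _ _))))
∣p∪q∣+∣p∩q∣≡∣p∣+∣q∣ (inside ∷ p) (outside ∷ q) = cong suc (∣p∪q∣+∣p∩q∣≡∣p∣+∣q∣ p q)
∣p∪q∣+∣p∩q∣≡∣p∣+∣q∣ (outside ∷ p) (inside ∷ q) =
  trans (cong suc (∣p∪q∣+∣p∩q∣≡∣p∣+∣q∣ p q)) (sym (+-suc _ _))
∣p∪q∣+∣p∩q∣≡∣p∣+∣q∣ (outside ∷ p) (outside ∷ q) = ∣p∪q∣+∣p∩q∣≡∣p∣+∣q∣ p q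

∣p∪q∣≤∣p∣+∣q∣ : (p q : Subset n) → ∣ p ∪ q ∣ ≤ ∣ p ∣ + ∣ q ∣
∣p∪q∣≤∣p∣+∣q∣ p q = subst (∣ p ∪ q ∣ ≤_) (∣p∪q∣+∣p∩q∣≡∣p∣+∣q∣ p q) (m≤m+n _ _)

Empty[p∩q]⇒∣p∪q∣≡∣p∣+∣q∣ : (p q : Subset n) → Empty (p ∩ q) → ∣ p ∪ q ∣ ≡ ∣ p ∣ + ∣ q ∣
Empty[p∩q]⇒∣p∪q∣≡∣p∣+∣q∣ {n} p q disjoint = begin
  ∣ p ∪ q ∣                ≡⟨ sym (+-identityʳ _) ⟩
  ∣ p ∪ q ∣ + 0            ≡⟨ cong (∣ p ∪ q ∣ +_) (sym (∣⊥∣≡0 n)) ⟩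
  ∣ p ∪ q ∣ + ∣ ∅ {n} ∣    ≡⟨ cong (λ r → ∣ p ∪ q ∣ + ∣ r ∣) (sym (Empty-unique disjoint)) ⟩
  ∣ p ∪ q ∣ + ∣ p ∩ q ∣    ≡⟨ ∣p∪q∣+∣p∩q∣≡∣p∣+∣q∣ p q ⟩
  ∣ p ∣ + ∣ q ∣            ∎
  where open ≡-Reasoning

Empty-∩-∪ : {p q r : Subset n} → Empty (p ∩ q) → Empty (p ∩ r) → Empty (p ∩ (q ∪ r))
Empty-∩-∪ {p = p} {q} {r} pq pr (x , x∈p∩[q∪r]) with x∈p∩q⁻ p (q ∪ r) x∈p∩[q∪r]
... | x∈p , x∈q∪r with x∈p∪q⁻ q r x∈q∪r
...   | inj₁ x∈q = pq (x , x∈p∩q⁺ (x∈p , x∈q))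
...   | inj₂ x∈r = pr (x , x∈p∩q⁺ (x∈p , x∈r))

Empty-∩-mono : {p p′ q q′ : Subset n} → p′ ⊆ₛ p → q′ ⊆ₛ q → Empty (p ∩ q) → Empty (p′ ∩ q′)
Empty-∩-mono {p′ = p′} {q′ = q′} p′⊆p q′⊆q pq (x , x∈p′∩q′) with x∈p∩q⁻ p′ q′ x∈p′∩q′
... | x∈p′ , x∈q′ = pq (x , x∈p∩q⁺ (p′⊆p x∈p′ , q′⊆q x∈q′))

Empty? : Decidable (Empty {n})
Empty? p = ¬? (nonempty? p)

size≡size↾+size↾∁ : (σ : PF n) (Z : Subset n) → size σ ≡ size (σ ↾ Z) + size (σ ↾ ∁ Z)
size≡size↾+size↾∁ [] [] = refl
size≡size↾+size↾∁ (just _ ∷ σ) (inside ∷ Z) = cong suc (size≡size↾+size↾∁ σ Z)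
size≡size↾+size↾∁ (just _ ∷ σ) (outside ∷ Z) =
  trans (cong suc (size≡size↾+size↾∁ σ Z)) (sym (+-suc _ _))
size≡size↾+size↾∁ (nothing ∷ σ) (inside ∷ Z) = size≡size↾+size↾∁ σ Z
size≡size↾+size↾∁ (nothing ∷ σ) (outside ∷ Z) = size≡size↾+size↾∁ σ Z

dom-↾-⊆ : (σ : PF n) (Z : Subset n) → dom (σ ↾ Z) ⊆ₛ dom σ
dom-↾-⊆ (just _ ∷ σ) (inside ∷ Z) here = here
dom-↾-⊆ (_ ∷ σ) (_ ∷ Z) (there x∈) = there (dom-↾-⊆ σ Z x∈)
dom-↾-⊆ (nothing ∷ σ) (inside ∷ Z) {Fin.zero} ()
dom-↾-⊆ (_ ∷ σ) (outside ∷ Z) {Fin.zero} ()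

m+n≤2*m : ∀ m n → n ≤ m → m + n ≤ 2 * m
m+n≤2*m m n n≤m = subst (m + n ≤_) (sym (cong (m +_) (+-identityʳ m))) (+-monoʳ-≤ m n≤m)

m+n≤2*n : ∀ m n → m ≤ n → m + n ≤ 2 * n
m+n≤2*n m n m≤n = subst (_≤ 2 * n) (+-comm n m) (m+n≤2*m n m m≤n)

size≤2*size↾ : (σ : PF n) (Z : Subset n) → size (σ ↾ ∁ Z) ≤ size (σ ↾ Z) → size σ ≤ 2 * size (σ ↾ Z)
size≤2*size↾ σ Z small =
  subst (_≤ 2 * size (σ ↾ Z)) (sym (size≡size↾+size↾∁ σ Z)) (m+n≤2*m _ _ small)

size≤2*size↾∁ : (σ : PF n) (Z : Subset n) → size (σ ↾ Z) < size (σ ↾ ∁ Z) → size σ ≤ 2 * size (σ ↾ ∁ Z)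
size≤2*size↾∁ σ Z small =
  subst (_≤ 2 * size (σ ↾ ∁ Z)) (sym (size≡size↾+size↾∁ σ Z)) (m+n≤2*n _ _ (<⇒≤ small))

totalSize : List (PF n) → ℕ
totalSize []      = 0
totalSize (σ ∷ γ) = size σ + totalSize γ

∣domUnion∣≤totalSize : (γ : List (PF n)) → ∣ domUnion γ ∣ ≤ totalSize γ
∣domUnion∣≤totalSize {n} [] = ≤-reflexive (∣⊥∣≡0 n)
∣domUnion∣≤totalSize (σ ∷ γ) =
  ≤-trans (∣p∪q∣≤∣p∣+∣q∣ (dom σ) (domUnion γ)) (+-monoʳ-≤ (size σ) (∣domUnion∣≤totalSize γ))

Empty-dom-∩-domUnion : (σ : PF n) (γ : List (PF n)) →
  All (λ τ → Empty (dom σ ∩ dom τ)) γ → Empty (dom σ ∩ domUnion γ)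
Empty-dom-∩-domUnion σ [] [] (x , x∈) = ∉⊥ (proj₂ (x∈p∩q⁻ (dom σ) ∅ x∈))
Empty-dom-∩-domUnion σ (τ ∷ γ) (στ ∷ σγ) = Empty-∩-∪ στ (Empty-dom-∩-domUnion σ γ σγ)

PairwiseDisjoint⇒∣domUnion∣≡totalSize : (γ : List (PF n)) → PairwiseDisjoint γ →
  ∣ domUnion γ ∣ ≡ totalSize γ
PairwiseDisjoint⇒∣domUnion∣≡totalSize {n} [] [] = ∣⊥∣≡0 n
PairwiseDisjoint⇒∣domUnion∣≡totalSize (σ ∷ γ) (σγ ∷ γ-disjoint) = trans
  (Empty[p∩q]⇒∣p∪q∣≡∣p∣+∣q∣ (dom σ) (domUnion γ) (Empty-dom-∩-domUnion σ γ σγ))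
  (cong (size σ +_) (PairwiseDisjoint⇒∣domUnion∣≡totalSize γ γ-disjoint))

PairwiseDisjoint-map : (f : PF n → PF n) → (∀ σ → dom (f σ) ⊆ₛ dom σ) →
  (γ : List (PF n)) → PairwiseDisjoint γ → PairwiseDisjoint (map f γ)
PairwiseDisjoint-map f shrink [] [] = []
PairwiseDisjoint-map f shrink (σ ∷ γ) (σγ ∷ γ-disjoint) =
  images γ σγ ∷ PairwiseDisjoint-map f shrink γ γ-disjoint
  where
  images : (γ : List (PF _)) → All (λ τ → Empty (dom σ ∩ dom τ)) γ →
    All (λ τ → Empty (dom (f σ) ∩ dom τ)) (map f γ)
  images []      []        = []
  images (τ ∷ γ) (στ ∷ σγ) = Empty-∩-mono (shrink σ) (shrink τ) στ ∷ images γ σγ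

module _ {a} {A : Set a} where

  deduplicate-⊆ : ∀ {r} {R : A → A → Set r} (R? : ∀ x y → Dec (R x y)) (xs : List A) →
    deduplicate R? xs ⊆ xs
  deduplicate-⊆ R? []       = []
  deduplicate-⊆ R? (x ∷ xs) = refl ∷ ⊆-trans (filter-⊆ _ _) (deduplicate-⊆ R? xs)

  map-⊆⁻ : ∀ {b} {B : Set b} (f : A → B) (xs : List A) {ys : List B} → ys ⊆ map f xs →
    Σ (List A) λ xs′ → xs′ ⊆ xs × map f xs′ ≡ ys
  map-⊆⁻ f []       []              = [] , [] , refl
  map-⊆⁻ f (x ∷ xs) (_ ∷ʳ ys⊆)      with map-⊆⁻ f xs ys⊆
  ... | xs′ , xs′⊆ , refl = xs′ , x ∷ʳ xs′⊆ , refl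
  map-⊆⁻ f (x ∷ xs) (refl ∷ ys⊆)    with map-⊆⁻ f xs ys⊆
  ... | xs′ , xs′⊆ , refl = x ∷ xs′ , refl ∷ xs′⊆ , refl

  all-sublists? : {Q : List A → Set} → (∀ ys → Dec (Q ys)) → ∀ xs → Dec (∀ ys → ys ⊆ xs → Q ys)
  all-sublists? Q? [] with Q? []
  ... | yes q  = yes λ { [] [] → q }
  ... | no ¬q  = no λ all → ¬q (all [] [])
  all-sublists? Q? (x ∷ xs)
    with all-sublists? Q? xs ×-dec all-sublists? (λ ys → Q? (x ∷ ys)) xs
  ... | yes (without , with-x) = yes λ { ys (_ ∷ʳ ys⊆) → without ys ys⊆
                                        ; (_ ∷ ys) (refl ∷ ys⊆) → with-x ys ys⊆ }
  ... | no ¬both = no λ all → ¬both ( (λ ys ys⊆ → all ys (x ∷ʳ ys⊆))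
                                    , (λ ys ys⊆ → all (x ∷ ys) (refl ∷ ys⊆)))

  any-sublist? : {Q : List A → Set} → (∀ ys → Dec (Q ys)) → ∀ xs →
    Dec (Σ (List A) λ ys → ys ⊆ xs × Q ys)
  any-sublist? Q? [] with Q? []
  ... | yes q = yes ([] , [] , q)
  ... | no ¬q = no λ { ([] , [] , q) → ¬q q }
  any-sublist? Q? (x ∷ xs) with any-sublist? Q? xs | any-sublist? (λ ys → Q? (x ∷ ys)) xs
  ... | yes (ys , ys⊆ , q) | _                  = yes (ys , x ∷ʳ ys⊆ , q)
  ... | no _               | yes (ys , ys⊆ , q) = yes (x ∷ ys , refl ∷ ys⊆ , q)
  ... | no ¬without        | no ¬with-x         =
    no λ { (ys , _ ∷ʳ ys⊆ , q) → ¬without (ys , ys⊆ , q)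
         ; (_ ∷ ys , refl ∷ ys⊆ , q) → ¬with-x (ys , ys⊆ , q) }

Good? : (δ : List (PF n)) (k : ℕ) → Dec (Good δ k)
Good? δ k = all-sublists? (λ δ′ → any-sublist?
  (λ δ″ → allPairs? (λ σ τ → Empty? (dom σ ∩ dom τ)) δ″ ×-dec (k * length δ′ ≤? ∣ domUnion δ″ ∣)) δ′) δ

greatest-below : {P : Pred ℕ 0ℓ} (P? : Decidable P) → ∀ m {k₀} → k₀ < m → P k₀ →
  Σ ℕ λ k → k₀ ≤ k × k < m × P k × (∀ k′ → k′ < m → P k′ → k′ ≤ k)
greatest-below {P = P} P? (suc m) {k₀} k₀<1+m pk₀ with P? m | m≤n⇒m<n∨m≡n (≤-pred k₀<1+m)
... | yes pm  | _           = m , ≤-pred k₀<1+m , ≤-refl , pm , λ _ k′<1+m _ → ≤-pred k′<1+m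
... | no ¬pm  | inj₂ refl   = ⊥-elim (¬pm pk₀)
... | no ¬pm  | inj₁ k₀<m   with greatest-below P? m k₀<m pk₀
...   | k , k₀≤k , k<m , pk , max = k , k₀≤k , m<n⇒m<1+n k<m , pk , max′
  where
  max′ : ∀ k′ → k′ < suc m → P k′ → k′ ≤ k
  max′ k′ k′<1+m pk′ with m≤n⇒m<n∨m≡n (≤-pred k′<1+m)
  ... | inj₁ k′<m = max k′ k′<m pk′
  ... | inj₂ refl = ⊥-elim (¬pm pk′)

Good⇒IsHn : (δ : List (PF n)) {k : ℕ} → k < n → Good δ k → Σ ℕ λ h → IsHn δ h × k < h
Good⇒IsHn {n} δ k<n good with greatest-below (Good? δ) n k<n good
... | k′ , k≤k′ , k′<n , good′ , max = suc k′ , (k′ , refl , k′<n , good′ , max) , s≤s k≤k′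

2*⌊n/2⌋≤n : ∀ n → 2 * ⌊ n /2⌋ ≤ n
2*⌊n/2⌋≤n zero          = z≤n
2*⌊n/2⌋≤n (suc zero)    = z≤n
2*⌊n/2⌋≤n (suc (suc n)) = subst (_≤ suc (suc n)) (sym (*-suc 2 ⌊ n /2⌋)) (s≤s (s≤s (2*⌊n/2⌋≤n n)))

1+n≤2*[1+⌊n/2⌋] : ∀ n → suc n ≤ 2 * suc ⌊ n /2⌋
1+n≤2*[1+⌊n/2⌋] zero          = s≤s z≤n
1+n≤2*[1+⌊n/2⌋] (suc zero)    = s≤s (s≤s z≤n)
1+n≤2*[1+⌊n/2⌋] (suc (suc n)) =
  subst (3 + n ≤_) (sym (*-suc 2 (suc ⌊ n /2⌋))) (s≤s (s≤s (1+n≤2*[1+⌊n/2⌋] n)))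

-- Lset δ Z and Rset δ Z are, definitionally, images under a restriction map.
image : (f : PF n → PF n) {P : Pred (PF n) 0ℓ} → Decidable P → List (PF n) → List (PF n)
image f P? δ = deduplicate _≟PF_ (map f (filter P? δ))

module HalvingImage (f : PF n → PF n) {P : Pred (PF n) 0ℓ} (P? : Decidable P)
  (halves : ∀ σ → P σ → size σ ≤ 2 * size (f σ))
  (shrinks : ∀ σ → dom (f σ) ⊆ₛ dom σ) where

  totalSize≤2*totalSize-map : (γ : List (PF n)) → All P γ → totalSize γ ≤ 2 * totalSize (map f γ)
  totalSize≤2*totalSize-map []      []       = z≤n
  totalSize≤2*totalSize-map (σ ∷ γ) (pσ ∷ pγ) =
    subst (size σ + totalSize γ ≤_) (sym (*-distribˡ-+ 2 (size (f σ)) (totalSize (map f γ))))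
      (+-mono-≤ (halves σ pσ) (totalSize≤2*totalSize-map γ pγ))

  Good-image : ∀ δ k → Good δ k → Good (image f P? δ) ⌊ k /2⌋
  Good-image δ k good δ′ δ′⊆
    with map-⊆⁻ f (filter P? δ) (⊆-trans δ′⊆ (deduplicate-⊆ _≟PF_ _))
  ... | γ , γ⊆ , refl with good γ (⊆-trans γ⊆ (filter-⊆ P? δ))
  ... | γ″ , γ″⊆γ , disjoint , covers =
    map f γ″ , map⁺ f γ″⊆γ , disjoint′ , half-covers
    where
    disjoint′ : PairwiseDisjoint (map f γ″)
    disjoint′ = PairwiseDisjoint-map f shrinks γ″ disjoint

    twice-covers : 2 * (⌊ k /2⌋ * length γ) ≤ 2 * ∣ domUnion (map f γ″) ∣
    twice-covers = begin
      2 * (⌊ k /2⌋ * length γ)        ≡⟨ sym (*-assoc 2 ⌊ k /2⌋ (length γ)) ⟩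
      2 * ⌊ k /2⌋ * length γ          ≤⟨ *-monoˡ-≤ (length γ) (2*⌊n/2⌋≤n k) ⟩
      k * length γ                    ≤⟨ covers ⟩
      ∣ domUnion γ″ ∣                 ≤⟨ ∣domUnion∣≤totalSize γ″ ⟩
      totalSize γ″                    ≤⟨ totalSize≤2*totalSize-map γ″
                                           (All-resp-⊆ γ″⊆γ (All-resp-⊆ γ⊆ (all-filter P? δ))) ⟩
      2 * totalSize (map f γ″)        ≡⟨ cong (2 *_) (sym (PairwiseDisjoint⇒∣domUnion∣≡totalSize _ disjoint′)) ⟩
      2 * ∣ domUnion (map f γ″) ∣     ∎
      where open ≤-Reasoning

    half-covers : ⌊ k /2⌋ * length (map f γ) ≤ ∣ domUnion (map f γ″) ∣
    half-covers = subst (λ l → ⌊ k /2⌋ * l ≤ _) (sym (length-map f γ)) (*-cancelˡ-≤ 2 twice-covers)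

  hn-image : ∀ δ h → IsHn δ h → Σ ℕ λ h′ → IsHn (image f P? δ) h′ × h ≤ 2 * h′
  hn-image δ _ (k , refl , k<n , good , _)
    with Good⇒IsHn (image f P? δ) (≤-<-trans (⌊n/2⌋≤n k) k<n) (Good-image δ k good)
  ... | h′ , hn′ , ⌊k/2⌋<h′ = h′ , hn′ , ≤-trans (1+n≤2*[1+⌊n/2⌋] k) (*-monoʳ-≤ 2 ⌊k/2⌋<h′)

mainTheorem17 : (N : ℕ) (δ : List (PF N)) → Unique δ → (Z : Subset N)
    → (h : ℕ) → IsHn δ h → 1 < h
    → (Σ ℕ λ hL → IsHn (Lset δ Z) hL × h ≤ 2 * hL)
      × (Σ ℕ λ hR → IsHn (Rset δ Z) hR × h ≤ 2 * hR)
mainTheorem17 N δ _ Z h hn _ =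
    HalvingImage.hn-image (_↾ Z) (λ σ → size (σ ↾ ∁ Z) ≤? size (σ ↾ Z))
      (λ σ → size≤2*size↾ σ Z) (λ σ → dom-↾-⊆ σ Z) δ h hn
  , HalvingImage.hn-image (_↾ ∁ Z) (λ σ → size (σ ↾ Z) <? size (σ ↾ ∁ Z))
      (λ σ → size≤2*size↾∁ σ Z) (λ σ → dom-↾-⊆ σ (∁ Z)) δ h hn
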